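{- Let $p$ be a prime. Let $A=(a_1,\dots,a_\ell)$ be a regular sequence of $\ell$ elements of $\mathbb{F}_p^*$, and let $B=(b_1,\dots,b_\ell)$ be a sequence of $\ell$ elements of $\mathbb{F}_p$ such that $\mathcal{S}_A\subseteq\mathcal{S}_B$. Then for all $i,j\in[1,\ell]$, $a_i=a_j$ implies $b_i=b_j$.
   Context: For a sequence $C=(c_1,\dots,c_\ell)$, $\mathcal{S}_C=\{x\in\{0,1\}^\ell : \sum_i c_ix_i=0 \text{ in } \mathbb{F}_p\}$, each $x$ identified with the subset $\{i : x_i=1\}$ of $[1,\ell]$. A sequence $A$ of nonzero elements is exceptional if there exist two distinct $i,j\in[1,\ell]$ with $|\{i,j\}\cap x|\in\{0,2\}$ for all $x\in\mathcal{S}_A$, and regular otherwise, i.e. for any two distinct $i,j$ there is $x\in\mathcal{S}_A$ with $|\{i,j\}\cap x|=1$. (The paper introduces these notions for sequences of length $\ell\leqslant p$.) -}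

module Defs where

open import Data.Nat using (ℕ; zero; suc; _+_; _*_)
open import Data.Nat.Divisibility using (_∣_)
open import Data.Fin using (Fin; toℕ)
open import Data.Bool using (Bool; true; false)
open import Data.List using (map; allFin)
open import Data.Nat.ListAction using (sum)
open import Data.Product using (Σ; _×_)
open import Relation.Binary.PropositionalEquality using (_≡_; _≢_)

-- Elements of 𝔽_p are represented by Fin p (canonical residues 0,…,p-1).
-- A sequence of length ℓ over 𝔽_p is a function Fin ℓ → Fin p.
-- x ∈ {0,1}^ℓ is a function Fin ℓ → Bool; i ∈ x iff x i ≡ true.

ind : Bool → ℕ
ind true  = 1
ind false = 0

weightedSum : {p ℓ : ℕ} → (Fin ℓ → Fin p) → (Fin ℓ → Bool) → ℕ
weightedSum {ℓ = ℓ} c x = sum (map (λ i → toℕ (c i) * ind (x i)) (allFin ℓ))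

InS : {p ℓ : ℕ} → (Fin ℓ → Fin p) → (Fin ℓ → Bool) → Set
InS {p} c x = p ∣ weightedSum c x

SubsetS : {p ℓ : ℕ} → (Fin ℓ → Fin p) → (Fin ℓ → Fin p) → Set
SubsetS {ℓ = ℓ} a b = (x : Fin ℓ → Bool) → InS a x → InS b x

pairCount : {ℓ : ℕ} → (Fin ℓ → Bool) → Fin ℓ → Fin ℓ → ℕ
pairCount x i j = ind (x i) + ind (x j)

AllNonzero : {p ℓ : ℕ} → (Fin ℓ → Fin p) → Set
AllNonzero {ℓ = ℓ} a = (i : Fin ℓ) → toℕ (a i) ≢ 0

Regular : {p ℓ : ℕ} → (Fin ℓ → Fin p) → Set
Regular {ℓ = ℓ} a =
  (i j : Fin ℓ) → i ≢ j → Σ (Fin ℓ → Bool) (λ x → InS a x × pairCount x i j ≡ 1)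

module Submission where

-- Let x ∈ 𝒮_A separate i and j, say x_i = 1 and x_j = 0 (regularity
-- provides such an x).  Let z = x with coordinate i cleared, and y = z with
-- coordinate j set.  For every weight sequence C,
--     Σ C·x = Σ C·z + c_i      and      Σ C·y = Σ C·z + c_j .
-- Since a_i = a_j, Σ A·y = Σ A·x, so y ∈ 𝒮_A as well.  By 𝒮_A ⊆ 𝒮_B both
-- Σ B·z + b_i and Σ B·z + b_j are divisible by p; as b_i, b_j are residues
-- below p this forces b_i = b_j.

open import Defs
open import Data.Nat using (ℕ; _≤_)
open import Data.Nat.Primality using (Prime)
open import Data.Fin using (Fin)
open import Relation.Binary.PropositionalEquality using (_≡_)

open import Algebra.Bundles using (CommutativeMonoid)
open import Data.Nat using (zero; suc; _+_; _*_; _∸_; _<_)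
open import Data.Nat.Properties
  using (+-0-commutativeMonoid; +-assoc; +-identityʳ; *-zeroʳ; *-identityʳ; ≤-total;
         ≤-antisym; ≤-<-trans; m∸n≤m; m∸n≡0⇒m≤n; m+[n∸m]≡n)
open import Data.Nat.Divisibility using (_∣_; ∣m+n∣m⇒∣n; >⇒∤)
open import Data.Fin as Fin using (toℕ; punchIn; _≟_)
open import Data.Fin.Properties using (toℕ<n; toℕ-injective; punchInᵢ≢i)
open import Data.Bool using (Bool; true; false)
open import Data.List using (tabulate)
open import Data.List.Properties using (map-tabulate)
import Data.Nat.ListAction as List
open import Function using (_∘_)
open import Data.Vec.Functional using (Vector; removeAt; updateAt)
open import Data.Vec.Functional.Properties using (updateAt-updates; updateAt-minimal)
open import Data.Product using (_,_)
open import Data.Sum using (inj₁; inj₂)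
open import Data.Empty using (⊥-elim)
open import Relation.Nullary using (yes; no)
open import Relation.Binary.PropositionalEquality
  using (_≢_; refl; sym; trans; cong; subst; module ≡-Reasoning)

module AgreeOff {c ℓ} (M : CommutativeMonoid c ℓ) where
  open CommutativeMonoid M
  open import Algebra.Properties.CommutativeMonoid.Sum M using (sum; sum-remove; sum-cong-≋)
  open import Relation.Binary.Reasoning.Setoid setoid

  swap-outer : ∀ a b d → (a ∙ b) ∙ d ≈ (d ∙ b) ∙ a
  swap-outer a b d = begin
    (a ∙ b) ∙ d  ≈⟨ comm (a ∙ b) d ⟩
    d ∙ (a ∙ b)  ≈⟨ ∙-congˡ (comm a b) ⟩
    d ∙ (b ∙ a)  ≈⟨ assoc d b a ⟨
    (d ∙ b) ∙ a  ∎

  sum-agreeOff : ∀ {n} (f g : Vector Carrier n) (k : Fin n) →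
                 (∀ m → m ≢ k → f m ≈ g m) → sum f ∙ g k ≈ sum g ∙ f k
  sum-agreeOff {suc n} f g k agree = begin
    sum f ∙ g k                         ≈⟨ ∙-congʳ (sum-remove f) ⟩
    (f k ∙ sum (removeAt f k)) ∙ g k    ≈⟨ ∙-congʳ (∙-congˡ (sum-cong-≋ rest)) ⟩
    (f k ∙ sum (removeAt g k)) ∙ g k    ≈⟨ swap-outer (f k) _ (g k) ⟩
    (g k ∙ sum (removeAt g k)) ∙ f k    ≈⟨ ∙-congʳ (sum-remove g) ⟨
    sum g ∙ f k                         ∎
    where
    rest : ∀ m → removeAt f k m ≈ removeAt g k m
    rest m = agree (punchIn k m) (punchInᵢ≢i k m)

open AgreeOff +-0-commutativeMonoid using (sum-agreeOff)
open import Algebra.Properties.CommutativeMonoid.Sum +-0-commutativeMonoid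
  using () renaming (sum to ∑)

listSum≡∑ : ∀ {n} (f : Fin n → ℕ) → List.sum (tabulate f) ≡ ∑ f
listSum≡∑ {zero}  f = refl
listSum≡∑ {suc n} f = cong (f Fin.zero +_) (listSum≡∑ (f ∘ Fin.suc))

term : {p ℓ : ℕ} → (Fin ℓ → Fin p) → (Fin ℓ → Bool) → Fin ℓ → ℕ
term c x i = toℕ (c i) * ind (x i)

weightedSum≡∑ : {p ℓ : ℕ} (c : Fin ℓ → Fin p) (x : Fin ℓ → Bool) →
                weightedSum c x ≡ ∑ (term c x)
weightedSum≡∑ c x =
  trans (cong List.sum (map-tabulate (λ i → i) (term c x))) (listSum≡∑ (term c x))

weightedSum-toggle : {p ℓ : ℕ} (c : Fin ℓ → Fin p) (x z : Fin ℓ → Bool) (k : Fin ℓ) →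
                     (∀ m → m ≢ k → x m ≡ z m) → x k ≡ true → z k ≡ false →
                     weightedSum c x ≡ weightedSum c z + toℕ (c k)
weightedSum-toggle c x z k agree xk zk = begin
  weightedSum c x            ≡⟨ weightedSum≡∑ c x ⟩
  ∑ (term c x)               ≡⟨ +-identityʳ (∑ (term c x)) ⟨
  ∑ (term c x) + 0           ≡⟨ cong (∑ (term c x) +_) z-term≡0 ⟨
  ∑ (term c x) + term c z k  ≡⟨ sum-agreeOff (term c x) (term c z) k same-terms ⟩
  ∑ (term c z) + term c x k  ≡⟨ cong (∑ (term c z) +_) x-term≡ck ⟩
  ∑ (term c z) + toℕ (c k)   ≡⟨ cong (_+ toℕ (c k)) (weightedSum≡∑ c z) ⟨
  weightedSum c z + toℕ (c k) ∎
  where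
  open ≡-Reasoning
  same-terms : ∀ m → m ≢ k → term c x m ≡ term c z m
  same-terms m m≢k = cong (λ b → toℕ (c m) * ind b) (agree m m≢k)
  z-term≡0 : term c z k ≡ 0
  z-term≡0 = trans (cong (λ b → toℕ (c k) * ind b) zk) (*-zeroʳ (toℕ (c k)))
  x-term≡ck : term c x k ≡ toℕ (c k)
  x-term≡ck = trans (cong (λ b → toℕ (c k) * ind b) xk) (*-identityʳ (toℕ (c k)))

multiple-below⇒0 : ∀ {p d} → p ∣ d → d < p → d ≡ 0
multiple-below⇒0 {d = zero}  _   _   = refl
multiple-below⇒0 {d = suc _} p∣d d<p = ⊥-elim (>⇒∤ d<p p∣d)

-- If s + u and s + v are both multiples of p and u ≤ v < p, then u = v:
-- p divides the difference v ∸ u, which lies below p.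
residues-equal-≤ : ∀ {p} s {u v} → u ≤ v → v < p → p ∣ s + u → p ∣ s + v → u ≡ v
residues-equal-≤ {p} s {u} {v} u≤v v<p p∣s+u p∣s+v =
  ≤-antisym u≤v (m∸n≡0⇒m≤n (multiple-below⇒0 p∣v∸u (≤-<-trans (m∸n≤m v u) v<p)))
  where
  split : s + v ≡ (s + u) + (v ∸ u)
  split = trans (cong (s +_) (sym (m+[n∸m]≡n u≤v))) (sym (+-assoc s u (v ∸ u)))
  p∣v∸u : p ∣ v ∸ u
  p∣v∸u = ∣m+n∣m⇒∣n (subst (p ∣_) split p∣s+v) p∣s+u

residues-equal : ∀ {p} s {u v} → u < p → v < p → p ∣ s + u → p ∣ s + v → u ≡ v
residues-equal s {u} {v} u<p v<p p∣s+u p∣s+v with ≤-total u v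
... | inj₁ u≤v = residues-equal-≤ s u≤v v<p p∣s+u p∣s+v
... | inj₂ v≤u = sym (residues-equal-≤ s v≤u u<p p∣s+v p∣s+u)

exchange : {p ℓ : ℕ} (a b : Fin ℓ → Fin p) → SubsetS a b →
           (i j : Fin ℓ) → i ≢ j → (x : Fin ℓ → Bool) → InS a x →
           x i ≡ true → x j ≡ false → a i ≡ a j → b i ≡ b j
exchange {p} a b 𝒮a⊆𝒮b i j i≢j x x∈𝒮a xi xj ai≡aj =
  toℕ-injective (residues-equal (weightedSum b z) (toℕ<n (b i)) (toℕ<n (b j))
    (subst (p ∣_) (x-vs-z b) (𝒮a⊆𝒮b x x∈𝒮a))
    (subst (p ∣_) (y-vs-z b) (𝒮a⊆𝒮b y y∈𝒮a)))
  where
  z y : Fin _ → Bool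
  z = updateAt x i (λ _ → false)
  y = updateAt z j (λ _ → true)

  zj : z j ≡ false
  zj = trans (updateAt-minimal j i x (λ j≡i → i≢j (sym j≡i))) xj

  x-vs-z : ∀ c → weightedSum c x ≡ weightedSum c z + toℕ (c i)
  x-vs-z c = weightedSum-toggle c x z i (λ m m≢i → sym (updateAt-minimal m i x m≢i))
               xi (updateAt-updates i x)

  y-vs-z : ∀ c → weightedSum c y ≡ weightedSum c z + toℕ (c j)
  y-vs-z c = weightedSum-toggle c y z j (λ m m≢j → updateAt-minimal m j z m≢j)
               (updateAt-updates j z) zj

  y∈𝒮a : InS a y
  y∈𝒮a = subst (p ∣_) x≡y x∈𝒮a
    where
    open ≡-Reasoning
    x≡y : weightedSum a x ≡ weightedSum a y
    x≡y = begin
      weightedSum a x              ≡⟨ x-vs-z a ⟩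
      weightedSum a z + toℕ (a i)  ≡⟨ cong (λ c → weightedSum a z + toℕ c) ai≡aj ⟩
      weightedSum a z + toℕ (a j)  ≡⟨ y-vs-z a ⟨
      weightedSum a y              ∎

lemma4p1 : (p : ℕ) → Prime p → (ℓ : ℕ) → ℓ ≤ p →
    (a b : Fin ℓ → Fin p) → AllNonzero a → Regular a → SubsetS a b →
    (i j : Fin ℓ) → a i ≡ a j → b i ≡ b j
lemma4p1 p _ ℓ _ a b _ regular 𝒮a⊆𝒮b i j ai≡aj with i ≟ j
... | yes i≡j = cong b i≡j
... | no i≢j with regular i j i≢j
... | x , x∈𝒮a , meets-once with x i in xi | x j in xj
...   | true  | false = exchange a b 𝒮a⊆𝒮b i j i≢j x x∈𝒮a xi xj ai≡aj
...   | false | true  =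
        sym (exchange a b 𝒮a⊆𝒮b j i (λ j≡i → i≢j (sym j≡i)) x x∈𝒮a xj xi (sym ai≡aj))
...   | true  | true  with () ← meets-once
...   | false | false with () ← meets-once
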